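{- Let $r\ge 2$, $n\ge3$, and let $v_i$ ($0\le i<c_{n-2}$) be a northwest corner of $\mathcal{D}_n$. Suppose $t(i)$ exists and $t(i)-i=c_m-wc_{m-1}$ for some integers $m\ge3$ and $2\le w\le r-1$. Then the Christoffel word of the subpath $\gamma(i,t(i))$ of $\mathcal{D}_n$ from $v_i$ to $v_{t(i)}$ equals $\lambda^{m-2}(E^{r-w-1}N)$ (with $\lambda^0$ the identity), and this subpath has length $c_{m+1}-wc_m$.
   Context: Define integers $c_1=0$, $c_2=1$, $c_n=rc_{n-1}-c_{n-2}$ for $n\ge 3$. For coprime nonnegative integers $a,b$, the maximal Dyck path $\mathcal{P}(a,b)$ is the lattice path from $(0,0)$ to $(a,b)$ using unit north and east steps that never passes strictly above the segment from $(0,0)$ to $(a,b)$ and whose height at each vertex is maximal among such paths. $\mathcal{D}_n=\mathcal{P}(c_{n-1}-c_{n-2},c_{n-2})$; its northwest corners (leftmost vertex at each height) are $v_0,\dots,v_{c_{n-2}}$, with $v_j$ at height $j$. Let $s=c_{n-2}/(c_{n-1}-c_{n-2})$ be the slope of the diagonal of $\mathcal{D}_n$, and for vertices $u,u'$ let $s(u,u')$ be the slope of the segment between them. $t(i)$ is the smallest $k$ with $i<k\le c_{n-2}$ and $s(v_i,v_k)>s$, when such $k$ exists. The Christoffel word of a subpath is the word in $\{E,N\}$ recording its east ($E$) and north ($N$) steps in order; its length is its number of steps. $\lambda$ is the word morphism $E\mapsto E^{r-1}N$, $N\mapsto E^{r-2}N$. -}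

module Defs where

open import Data.Nat using (ℕ; zero; suc; _+_; _*_; _∸_; _≤_; _<_; _≤?_; _≟_)
open import Data.Bool using (Bool; true; false; if_then_else_)
open import Data.List using (List; []; _∷_; _++_; take; drop; length; replicate; concatMap)
open import Data.Product using (_×_; _,_; proj₁; proj₂)
open import Relation.Nullary using (¬_; yes; no)
open import Relation.Nullary.Decidable using (⌊_⌋)

-- Index 0 is an unused dummy value.  For r ≥ 2 the sequence is nondecreasing,
-- so truncated subtraction agrees with integer subtraction.
c : ℕ → ℕ → ℕ
c r zero = 0
c r (suc zero) = 0
c r (suc (suc zero)) = 1
c r (suc (suc (suc k))) = r * c r (suc (suc k)) ∸ c r (suc k)

data Step : Set where
  E N : Step

Word : Set
Word = List Step

-- Greedy construction of the maximal Dyck path P(a,b): from the current vertex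
-- (x , y) take a north step whenever the new vertex (x , y+1) stays weakly below
-- the diagonal y = (b/a) x, i.e. (y+1)·a ≤ b·x; otherwise step east.
maxPathGo : (a b fuel x y : ℕ) → Word
maxPathGo a b zero x y = []
maxPathGo a b (suc f) x y with suc y * a ≤? b * x
... | yes _ = N ∷ maxPathGo a b f x (suc y)
... | no _  = E ∷ maxPathGo a b f (suc x) y

maxPath : ℕ → ℕ → Word
maxPath a b = maxPathGo a b (a + b) 0 0

countE : Word → ℕ
countE [] = 0
countE (E ∷ w) = suc (countE w)
countE (N ∷ w) = countE w

countN : Word → ℕ
countN [] = 0
countN (E ∷ w) = countN w
countN (N ∷ w) = suc (countN w)

vertex : Word → ℕ → ℕ × ℕ
vertex w p = countE (take p w) , countN (take p w)

firstHit : (ℕ → Bool) → ℕ → ℕ → ℕ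
firstHit P zero s = s
firstHit P (suc f) s = if P s then s else firstHit P f (suc s)

-- step-index of the northwest corner v_j of the path w: the first (hence
-- leftmost) vertex of w at height j
corner : Word → ℕ → ℕ
corner w j = firstHit (λ p → ⌊ proj₂ (vertex w p) ≟ j ⌋) (length w) 0

Da : ℕ → ℕ → ℕ
Da r n = c r (n ∸ 1) ∸ c r (n ∸ 2)

Db : ℕ → ℕ → ℕ
Db r n = c r (n ∸ 2)

D : ℕ → ℕ → Word
D r n = maxPath (Da r n) (Db r n)

v : ℕ → ℕ → ℕ → ℕ × ℕ
v r n j = vertex (D r n) (corner (D r n) j)

-- s(u,u') > s, where s = b/a, written by cross-multiplication
-- (u' lies weakly north-east of u):  (y' - y)/(x' - x) > b/a
SlopeGt : (a b : ℕ) → ℕ × ℕ → ℕ × ℕ → Set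
SlopeGt a b (x , y) (x' , y') = b * (x' ∸ x) < (y' ∸ y) * a

-- "t(i) exists and equals k"
IsT : (r n i k : ℕ) → Set
IsT r n i k =
  i < k × k ≤ Db r n × SlopeGt (Da r n) (Db r n) (v r n i) (v r n k)
  × (∀ k' → i < k' → k' < k → ¬ SlopeGt (Da r n) (Db r n) (v r n i) (v r n k'))

-- the Christoffel word (step word) of the subpath γ(i,k) of D_n from v_i to v_k
γ : (r n i k : ℕ) → Word
γ r n i k = take (corner (D r n) k ∸ corner (D r n) i) (drop (corner (D r n) i) (D r n))

λmor : ℕ → Word → Word
λmor r = concatMap f
  where
  f : Step → Word
  f E = replicate (r ∸ 1) E ++ (N ∷ [])
  f N = replicate (r ∸ 2) E ++ (N ∷ [])

iter : ℕ → (Word → Word) → Word → Word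
iter zero g w = w
iter (suc k) g w = g (iter k g w)

module Submission where

-- On P(a,b) the northwest corner at height j lies at abscissa ⌈ja/b⌉, so the subpath between
-- two corners is the staircase read off from these ceilings.  If v_{i+d} is the first corner
-- seen from v_i at slope above the diagonal and p is their horizontal distance, a best
-- approximation argument shows that the corners in between follow the maximal path of the
-- chord: γ(i, t(i)) = P(p, d).  On the other side λ maps P(p, d) to P(p + (r-2)(p+d), p + d),
-- so λ^{m-2}(E^{r-w-1} N) = P(P_{m-2}, H_{m-2}) with H_j + w c_{j+1} = c_{j+2}.  The hypothesis
-- says d = H_{m-2}, and Cassini-type identities for c show that H_{m-1} = P_{m-2} + H_{m-2} is,
-- like p + d, the integer s with s c_{n-2} < d c_{n-1} ≤ (s + 1) c_{n-2}.  Hence p = P_{m-2},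
-- and the length is p + d = H_{m-1} = c_{m+1} - w c_m.

open import Defs
open import Data.Bool using (true; false)
open import Data.Empty using (⊥-elim)
open import Data.List using ([]; _∷_; _++_; take; drop; length; replicate)
open import Data.List.Properties using (++-assoc; length-++; length-replicate)
open import Data.Nat
open import Data.Nat.DivMod using (_/_; _%_; m≡m%n+[m/n]*n; m%n<n; m/n*n≤m)
open import Data.Nat.Properties
open import Data.Nat.Tactic.RingSolver using (solve-∀)
open import Data.Product using (_×_; _,_; proj₁; proj₂)
open import Data.Sum using (_⊎_; inj₁; inj₂)
open import Relation.Binary.PropositionalEquality
open import Relation.Nullary using (yes; no)
open import Relation.Nullary.Decidable using (⌊_⌋; isYes≗does; dec-true; dec-false)

⌈_/_⌉ : ℕ → ℕ → ℕ
⌈ m / zero ⌉ = 0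
⌈ m / suc n ⌉ = (m + n) / suc n

m≤⌈m/n⌉*n : ∀ m n → 0 < n → m ≤ ⌈ m / n ⌉ * n
m≤⌈m/n⌉*n m (suc n) _ = +-cancelʳ-≤ n m (q * suc n) (<⇒≤pred (begin-strict
    m + n                        ≡⟨ m≡m%n+[m/n]*n (m + n) (suc n) ⟩
    (m + n) % suc n + q * suc n  <⟨ +-monoˡ-< (q * suc n) (m%n<n (m + n) (suc n)) ⟩
    suc n + q * suc n            ≡⟨ cong suc (+-comm n (q * suc n)) ⟩
    suc (q * suc n + n)          ∎))
  where
  open ≤-Reasoning
  q = ⌈ m / suc n ⌉

⌈m/n⌉*n<m+n : ∀ m n → 0 < n → ⌈ m / n ⌉ * n < m + n
⌈m/n⌉*n<m+n m (suc n) _ = begin-strict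
    (m + n) / suc n * suc n  ≤⟨ m/n*n≤m (m + n) (suc n) ⟩
    m + n                    <⟨ +-monoʳ-< m (n<1+n n) ⟩
    m + suc n                ∎
  where open ≤-Reasoning

⌈m/n⌉≤q : ∀ m n q → 0 < n → m ≤ q * n → ⌈ m / n ⌉ ≤ q
⌈m/n⌉≤q m n q n>0 m≤qn = s≤s⁻¹ (*-cancelʳ-< n ⌈ m / n ⌉ (suc q) (begin-strict
    ⌈ m / n ⌉ * n  <⟨ ⌈m/n⌉*n<m+n m n n>0 ⟩
    m + n          ≤⟨ +-monoˡ-≤ n m≤qn ⟩
    q * n + n      ≡⟨ +-comm (q * n) n ⟩
    suc q * n      ∎))
  where open ≤-Reasoning

q≤⌈m/n⌉ : ∀ m n q → 0 < n → q * n < m + n → q ≤ ⌈ m / n ⌉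
q≤⌈m/n⌉ m n q n>0 qn<m+n = s≤s⁻¹ (*-cancelʳ-< n q (suc ⌈ m / n ⌉) (begin-strict
    q * n              <⟨ qn<m+n ⟩
    m + n              ≤⟨ +-monoˡ-≤ n (m≤⌈m/n⌉*n m n n>0) ⟩
    ⌈ m / n ⌉ * n + n  ≡⟨ +-comm (⌈ m / n ⌉ * n) n ⟩
    suc ⌈ m / n ⌉ * n  ∎))
  where open ≤-Reasoning

⌈m/n⌉≡q : ∀ m n q → 0 < n → m ≤ q * n → q * n < m + n → ⌈ m / n ⌉ ≡ q
⌈m/n⌉≡q m n q n>0 m≤qn qn<m+n = ≤-antisym (⌈m/n⌉≤q m n q n>0 m≤qn) (q≤⌈m/n⌉ m n q n>0 qn<m+n)

⌈/⌉-monoˡ-≤ : ∀ {m m′} n → 0 < n → m ≤ m′ → ⌈ m / n ⌉ ≤ ⌈ m′ / n ⌉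
⌈/⌉-monoˡ-≤ {m} {m′} n n>0 m≤m′ = ⌈m/n⌉≤q m n ⌈ m′ / n ⌉ n>0 (≤-trans m≤m′ (m≤⌈m/n⌉*n m′ n n>0))

⌈m/n⌉≤q⇒m≤q*n : ∀ m n q → 0 < n → ⌈ m / n ⌉ ≤ q → m ≤ q * n
⌈m/n⌉≤q⇒m≤q*n m n q n>0 ⌈m/n⌉≤q = ≤-trans (m≤⌈m/n⌉*n m n n>0) (*-monoˡ-≤ n ⌈m/n⌉≤q)

⌈m/n⌉≡1+q : ∀ m n q → 0 < n → q * n < m → m ≤ q * n + n → ⌈ m / n ⌉ ≡ suc q
⌈m/n⌉≡1+q m n q n>0 qn<m m≤qn+n = ⌈m/n⌉≡q m n (suc q) n>0
  (subst (m ≤_) (+-comm (q * n) n) m≤qn+n) (subst (n + q * n <_) (+-comm n m) (+-monoʳ-< n qn<m))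

-- Lattice paths given by coordinates

-- The path whose abscissa after p steps is Y p: step p is east iff Y increases there.
stepAt : (ℕ → ℕ) → ℕ → Step
stepAt Y p with Y (suc p) ≤? Y p
... | yes _ = N
... | no _  = E

walk : (ℕ → ℕ) → ℕ → ℕ → Word
walk Y p zero    = []
walk Y p (suc ℓ) = stepAt Y p ∷ walk Y (suc p) ℓ

-- The path whose leftmost vertex at height j has abscissa X j, read from height i for ℓ rows.
staircase : (ℕ → ℕ) → ℕ → ℕ → Word
staircase X i zero    = []
staircase X i (suc ℓ) = replicate (X (suc i) ∸ X i) E ++ N ∷ staircase X (suc i) ℓ

UnitSteps : (ℕ → ℕ) → Set
UnitSteps Y = ∀ p → Y p ≤ Y (suc p) × Y (suc p) ≤ suc (Y p)

stepAt-N : ∀ Y p → Y (suc p) ≡ Y p → stepAt Y p ≡ N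
stepAt-N Y p eq with Y (suc p) ≤? Y p
... | yes _ = refl
... | no nle = ⊥-elim (nle (≤-reflexive eq))

stepAt-E : ∀ Y p → Y (suc p) ≡ suc (Y p) → stepAt Y p ≡ E
stepAt-E Y p eq with Y (suc p) ≤? Y p
... | yes le = ⊥-elim (1+n≰n (≤-trans (≤-reflexive (sym eq)) le))
... | no _  = refl

unitSteps-cases : ∀ {Y} → UnitSteps Y → ∀ p → Y (suc p) ≡ Y p ⊎ Y (suc p) ≡ suc (Y p)
unitSteps-cases {Y} unit p with Y (suc p) ≤? Y p
... | yes le = inj₁ (≤-antisym le (proj₁ (unit p)))
... | no nle = inj₂ (≤-antisym (proj₂ (unit p)) (≰⇒> nle))

walk-++ : ∀ Y p ℓ ℓ′ → walk Y p (ℓ + ℓ′) ≡ walk Y p ℓ ++ walk Y (p + ℓ) ℓ′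
walk-++ Y p zero    ℓ′ rewrite +-identityʳ p = refl
walk-++ Y p (suc ℓ) ℓ′ rewrite walk-++ Y (suc p) ℓ ℓ′ | +-suc p ℓ = refl

drop-walk : ∀ Y p q ℓ → drop q (walk Y p ℓ) ≡ walk Y (p + q) (ℓ ∸ q)
drop-walk Y p zero    ℓ       rewrite +-identityʳ p = refl
drop-walk Y p (suc q) zero    = refl
drop-walk Y p (suc q) (suc ℓ) rewrite drop-walk Y (suc p) q ℓ | +-suc p q = refl

take-walk : ∀ Y p q ℓ → q ≤ ℓ → take q (walk Y p ℓ) ≡ walk Y p q
take-walk Y p zero    ℓ       _         = refl
take-walk Y p (suc q) (suc ℓ) (s≤s q≤ℓ) = cong (stepAt Y p ∷_) (take-walk Y (suc p) q ℓ q≤ℓ)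

length-walk : ∀ Y p ℓ → length (walk Y p ℓ) ≡ ℓ
length-walk Y p zero    = refl
length-walk Y p (suc ℓ) = cong suc (length-walk Y (suc p) ℓ)

walk-east : ∀ Y p ℓ → (∀ t → t < ℓ → Y (suc (p + t)) ≡ suc (Y (p + t))) → walk Y p ℓ ≡ replicate ℓ E
walk-east Y p zero    _    = refl
walk-east Y p (suc ℓ) east = cong₂ _∷_
  (stepAt-E Y p (subst (λ q → Y (suc q) ≡ suc (Y q)) (+-identityʳ p) (east 0 z<s)))
  (walk-east Y (suc p) ℓ (λ t t<ℓ → subst (λ q → Y (suc q) ≡ suc (Y q)) (+-suc p t) (east (suc t) (s<s t<ℓ))))

countE-walk : ∀ {Y} → UnitSteps Y → ∀ p ℓ → countE (walk Y p ℓ) + Y p ≡ Y (p + ℓ)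
countE-walk {Y} unit p zero rewrite +-identityʳ p = refl
countE-walk {Y} unit p (suc ℓ) with unitSteps-cases unit p
... | inj₁ eq rewrite stepAt-N Y p eq | +-suc p ℓ =
  trans (cong (countE (walk Y (suc p) ℓ) +_) (sym eq)) (countE-walk unit (suc p) ℓ)
... | inj₂ eq rewrite stepAt-E Y p eq | +-suc p ℓ =
  trans (sym (+-suc _ (Y p))) (trans (cong (countE (walk Y (suc p) ℓ) +_) (sym eq)) (countE-walk unit (suc p) ℓ))

countN-walk : ∀ {Y} → UnitSteps Y → ∀ p ℓ → countN (walk Y p ℓ) + Y (p + ℓ) ≡ ℓ + Y p
countN-walk {Y} unit p zero rewrite +-identityʳ p = refl
countN-walk {Y} unit p (suc ℓ) with unitSteps-cases unit p
... | inj₁ eq rewrite stepAt-N Y p eq | +-suc p ℓ =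
  cong suc (trans (countN-walk unit (suc p) ℓ) (cong (ℓ +_) eq))
... | inj₂ eq rewrite stepAt-E Y p eq | +-suc p ℓ =
  trans (countN-walk unit (suc p) ℓ) (trans (cong (ℓ +_) eq) (+-suc ℓ (Y p)))

staircase-cong : ∀ X X′ i i′ ℓ →
  (∀ l → l < ℓ → X (suc (i + l)) ∸ X (i + l) ≡ X′ (suc (i′ + l)) ∸ X′ (i′ + l)) →
  staircase X i ℓ ≡ staircase X′ i′ ℓ
staircase-cong X X′ i i′ zero    _    = refl
staircase-cong X X′ i i′ (suc ℓ) rows = cong₂ (λ e rest → replicate e E ++ N ∷ rest)
  (shift (+-identityʳ i) (+-identityʳ i′) (rows 0 z<s))
  (staircase-cong X X′ (suc i) (suc i′) ℓ (λ l l<ℓ → shift (+-suc i l) (+-suc i′ l) (rows (suc l) (s<s l<ℓ))))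
  where
  shift = subst₂ (λ u u′ → X (suc u) ∸ X u ≡ X′ (suc u′) ∸ X′ u′)

Monotone : (ℕ → ℕ) → Set
Monotone X = ∀ j → X j ≤ X (suc j)

monotone-≤ : ∀ {X} → Monotone X → ∀ {j k} → j ≤ k → X j ≤ X k
monotone-≤ {X} mono {j} {k} j≤k = subst (λ k → X j ≤ X k) (m+[n∸m]≡n j≤k) (go (k ∸ j))
  where
  go : ∀ e → X j ≤ X (j + e)
  go zero    = ≤-reflexive (cong X (sym (+-identityʳ j)))
  go (suc e) = ≤-trans (go e) (≤-trans (mono (j + e)) (≤-reflexive (cong X (sym (+-suc j e)))))

length-staircase : ∀ {X} → Monotone X → ∀ i ℓ → length (staircase X i ℓ) + X i ≡ X (i + ℓ) + ℓ
length-staircase {X} mono i zero rewrite +-identityʳ i = sym (+-identityʳ (X i))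
length-staircase {X} mono i (suc ℓ) = begin
    length (replicate e E ++ N ∷ rest) + X i  ≡⟨ cong (_+ X i) (length-++ (replicate e E)) ⟩
    (length (replicate e E) + suc (length rest)) + X i
      ≡⟨ cong (λ z → (z + suc (length rest)) + X i) (length-replicate e) ⟩
    (e + suc (length rest)) + X i              ≡⟨ rearrange e (length rest) (X i) ⟩
    suc (length rest) + (e + X i)              ≡⟨ cong (suc (length rest) +_) (m∸n+n≡m (mono i)) ⟩
    suc (length rest + X (suc i))              ≡⟨ cong suc (length-staircase mono (suc i) ℓ) ⟩
    suc (X (suc i + ℓ) + ℓ)                    ≡⟨ cong (λ z → suc (X z + ℓ)) (sym (+-suc i ℓ)) ⟩
    suc (X (i + suc ℓ) + ℓ)                    ≡⟨ sym (+-suc (X (i + suc ℓ)) ℓ) ⟩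
    X (i + suc ℓ) + suc ℓ                      ∎
  where
  open ≡-Reasoning
  e = X (suc i) ∸ X i
  rest = staircase X (suc i) ℓ
  rearrange : ∀ a b c → (a + suc b) + c ≡ suc b + (a + c)
  rearrange = solve-∀

-- Row j of the staircase X, from (X j , j) to (X (suc j) , j), is traversed by the walk Y
-- at the steps X j + j + t.
RowsOf : (ℕ → ℕ) → (ℕ → ℕ) → Set
RowsOf Y X = ∀ j t → t ≤ X (suc j) ∸ X j → Y (X j + j + t) ≡ X j + t

walk≡staircase : ∀ {Y X} → Monotone X → RowsOf Y X →
  ∀ ℓ i → walk Y (X i + i) ((X (i + ℓ) + (i + ℓ)) ∸ (X i + i)) ≡ staircase X i ℓ
walk≡staircase {Y} {X} mono rows zero i =
  cong (walk Y (X i + i)) (trans (cong (λ z → (X z + z) ∸ (X i + i)) (+-identityʳ i)) (n∸n≡0 (X i + i)))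
walk≡staircase {Y} {X} mono rows (suc ℓ) i = begin
    walk Y q ((X (i + suc ℓ) + (i + suc ℓ)) ∸ q)  ≡⟨ cong (walk Y q) length-split ⟩
    walk Y q (e + suc rest)                       ≡⟨ walk-++ Y q e (suc rest) ⟩
    walk Y q e ++ stepAt Y (q + e) ∷ walk Y (suc (q + e)) rest
      ≡⟨ cong₂ _++_ row-east (cong₂ _∷_ corner-north (cong (λ z → walk Y z rest) next-corner)) ⟩
    replicate e E ++ N ∷ walk Y (X (suc i) + suc i) rest
      ≡⟨ cong (λ w → replicate e E ++ N ∷ w) (walk≡staircase mono rows ℓ (suc i)) ⟩
    staircase X i (suc ℓ) ∎
  where
  open ≡-Reasoning
  q = X i + i
  e = X (suc i) ∸ X i
  rest = (X (suc i + ℓ) + (suc i + ℓ)) ∸ (X (suc i) + suc i)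
  e+Xi : e + X i ≡ X (suc i)
  e+Xi = m∸n+n≡m (mono i)
  next-corner : suc (q + e) ≡ X (suc i) + suc i
  next-corner = trans (rearrange (X i) i e) (cong (_+ suc i) e+Xi)
    where
    rearrange : ∀ x i e → suc (x + i + e) ≡ (e + x) + suc i
    rearrange = solve-∀
  length-split : (X (i + suc ℓ) + (i + suc ℓ)) ∸ q ≡ e + suc rest
  length-split = begin
      (X (i + suc ℓ) + (i + suc ℓ)) ∸ q  ≡⟨ cong (λ z → (X z + z) ∸ q) (+-suc i ℓ) ⟩
      (X (suc i + ℓ) + (suc i + ℓ)) ∸ q  ≡⟨ cong (_∸ q) (sym (m∸n+n≡m corners≤)) ⟩
      (rest + (X (suc i) + suc i)) ∸ q   ≡⟨ cong (λ z → (rest + (z + suc i)) ∸ q) (sym e+Xi) ⟩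
      (rest + ((e + X i) + suc i)) ∸ q   ≡⟨ cong (_∸ q) (rearrange rest e (X i) i) ⟩
      (q + (e + suc rest)) ∸ q           ≡⟨ m+n∸m≡n q (e + suc rest) ⟩
      e + suc rest                       ∎
    where
    corners≤ : X (suc i) + suc i ≤ X (suc i + ℓ) + (suc i + ℓ)
    corners≤ = +-mono-≤ (monotone-≤ mono (m≤m+n (suc i) ℓ)) (m≤m+n (suc i) ℓ)
    rearrange : ∀ r e x i → r + ((e + x) + suc i) ≡ (x + i) + (e + suc r)
    rearrange = solve-∀
  row-east : walk Y q e ≡ replicate e E
  row-east = walk-east Y q e (λ t t<e → begin
    Y (suc (q + t))  ≡⟨ cong Y (sym (+-suc q t)) ⟩
    Y (q + suc t)    ≡⟨ rows i (suc t) t<e ⟩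
    X i + suc t      ≡⟨ +-suc (X i) t ⟩
    suc (X i + t)    ≡⟨ cong suc (sym (rows i t (<⇒≤ t<e))) ⟩
    suc (Y (q + t))  ∎)
  corner-north : stepAt Y (q + e) ≡ N
  corner-north = stepAt-N Y (q + e) (begin
      Y (suc (q + e))                ≡⟨ cong Y next-corner ⟩
      Y (X (suc i) + suc i)          ≡⟨ cong Y (sym (+-identityʳ _)) ⟩
      Y (X (suc i) + suc i + 0)      ≡⟨ rows (suc i) 0 z≤n ⟩
      X (suc i) + 0                  ≡⟨ +-identityʳ _ ⟩
      X (suc i)                      ≡⟨ trans (sym e+Xi) (+-comm e (X i)) ⟩
      X i + e                        ≡⟨ sym (rows i e ≤-refl) ⟩
      Y (q + e)                      ∎)

∸1≡suc∸2 : ∀ {r} → 2 ≤ r → r ∸ 1 ≡ suc (r ∸ 2)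
∸1≡suc∸2 (s≤s (s≤s _)) = refl

-- λ makes step h of the walk into a row of width (Y (suc h) ∸ Y h) + (r ∸ 2).
λmor-walk : ∀ {r Y} → 2 ≤ r → UnitSteps Y → ∀ p ℓ → λmor r (walk Y p ℓ) ≡ staircase (λ h → Y h + (r ∸ 2) * h) p ℓ
λmor-walk r≥2 unit p zero = refl
λmor-walk {r} {Y} r≥2 unit p (suc ℓ) with unitSteps-cases unit p
... | inj₁ eq rewrite stepAt-N Y p eq = trans (++-assoc (replicate (r ∸ 2) E) (N ∷ []) _)
   (cong₂ (λ e rest → replicate e E ++ N ∷ rest) (sym row) (λmor-walk r≥2 unit (suc p) ℓ))
  where
  row : (Y (suc p) + (r ∸ 2) * suc p) ∸ (Y p + (r ∸ 2) * p) ≡ r ∸ 2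
  row rewrite eq | *-suc (r ∸ 2) p | +-comm (r ∸ 2) ((r ∸ 2) * p)
            | sym (+-assoc (Y p) ((r ∸ 2) * p) (r ∸ 2)) = m+n∸m≡n (Y p + (r ∸ 2) * p) (r ∸ 2)
... | inj₂ eq rewrite stepAt-E Y p eq = trans (++-assoc (replicate (r ∸ 1) E) (N ∷ []) _)
   (cong₂ (λ e rest → replicate e E ++ N ∷ rest) (sym row) (λmor-walk r≥2 unit (suc p) ℓ))
  where
  rearrange : ∀ a b c → suc (a + (b + c)) ≡ (a + c) + suc b
  rearrange = solve-∀
  row : (Y (suc p) + (r ∸ 2) * suc p) ∸ (Y p + (r ∸ 2) * p) ≡ r ∸ 1
  row rewrite eq | ∸1≡suc∸2 r≥2 | *-suc (r ∸ 2) p =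
    trans (cong (_∸ (Y p + (r ∸ 2) * p)) (rearrange (Y p) (r ∸ 2) ((r ∸ 2) * p)))
          (m+n∸m≡n (Y p + (r ∸ 2) * p) (suc (r ∸ 2)))

-- Maximal Dyck paths

firstHit≡ : ∀ P f s q → s ≤ q → q ≤ s + f → P q ≡ true → (∀ p → s ≤ p → p < q → P p ≡ false) →
  firstHit P f s ≡ q
firstHit≡ P zero    s q s≤q q≤s+f _   _      = ≤-antisym s≤q (≤-trans q≤s+f (≤-reflexive (+-identityʳ s)))
firstHit≡ P (suc f) s q s≤q q≤s+f hit before with m≤n⇒m<n∨m≡n s≤q
... | inj₂ refl rewrite hit = refl
... | inj₁ s<q rewrite before s ≤-refl s<q =
  firstHit≡ P f (suc s) q s<q (≤-trans q≤s+f (≤-reflexive (+-suc s f))) hit (λ p s<p p<q → before p (<⇒≤ s<p) p<q)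

-- The northwest corner of P(a,b) at height j is (⌈ja/b⌉ , j); the vertex after p steps has
-- abscissa ⌈pa/(a+b)⌉.
cornerX : ℕ → ℕ → ℕ → ℕ
cornerX a b j = ⌈ j * a / b ⌉

pathX : ℕ → ℕ → ℕ → ℕ
pathX a b p = ⌈ p * a / (a + b) ⌉

cornerX-monotone : ∀ a b → 0 < b → Monotone (cornerX a b)
cornerX-monotone a b b>0 j = ⌈/⌉-monoˡ-≤ b b>0 (m≤n+m (j * a) a)

cornerX-zero : ∀ a b → 0 < b → cornerX a b 0 ≡ 0
cornerX-zero a b b>0 = ⌈m/n⌉≡q 0 b 0 b>0 z≤n b>0

cornerX-top : ∀ a b → 0 < b → cornerX a b b ≡ a
cornerX-top a b b>0 = ⌈m/n⌉≡q (b * a) b a b>0 (≤-reflexive (*-comm b a))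
  (≤-trans (s≤s (≤-reflexive (*-comm a b))) (m<m+n (b * a) b>0))

pathX-unitSteps : ∀ a b → 0 < b → UnitSteps (pathX a b)
pathX-unitSteps a b b>0 p = ⌈/⌉-monoˡ-≤ (a + b) a+b>0 (m≤n+m (p * a) a)
  , ⌈m/n⌉≤q (suc p * a) (a + b) (suc (pathX a b p)) a+b>0 (begin
      a + p * a                         ≤⟨ +-monoʳ-≤ a (m≤⌈m/n⌉*n (p * a) (a + b) a+b>0) ⟩
      a + pathX a b p * (a + b)         ≤⟨ +-monoˡ-≤ _ (m≤m+n a b) ⟩
      suc (pathX a b p) * (a + b)       ∎)
  where
  open ≤-Reasoning
  a+b>0 = ≤-trans b>0 (m≤n+m b a)

pathX-rowsOf : ∀ a b → 0 < b → RowsOf (pathX a b) (cornerX a b)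
pathX-rowsOf a b b>0 j t t≤row = ⌈m/n⌉≡q ((x + j + t) * a) (a + b) (x + t) a+b>0 lower upper
  where
  open ≤-Reasoning
  a+b>0 = ≤-trans b>0 (m≤n+m b a)
  x = cornerX a b j
  x′ = cornerX a b (suc j)
  x+t≤x′ : x + t ≤ x′
  x+t≤x′ = ≤-trans (+-monoʳ-≤ x t≤row) (≤-reflexive (m+[n∸m]≡n (cornerX-monotone a b b>0 j)))
  lower : (x + j + t) * a ≤ (x + t) * (a + b)
  lower = begin
    (x + j + t) * a            ≡⟨ split x j t a ⟩
    (x + t) * a + j * a        ≤⟨ +-monoʳ-≤ _ (≤-trans (m≤⌈m/n⌉*n (j * a) b b>0) (*-monoˡ-≤ b (m≤m+n x t))) ⟩
    (x + t) * a + (x + t) * b  ≡⟨ sym (*-distribˡ-+ (x + t) a b) ⟩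
    (x + t) * (a + b)          ∎
    where
    split : ∀ x j t a → (x + j + t) * a ≡ (x + t) * a + j * a
    split = solve-∀
  upper : (x + t) * (a + b) < (x + j + t) * a + (a + b)
  upper = begin-strict
    (x + t) * (a + b)              ≡⟨ *-distribˡ-+ (x + t) a b ⟩
    (x + t) * a + (x + t) * b      ≤⟨ +-monoʳ-≤ _ (*-monoˡ-≤ b x+t≤x′) ⟩
    (x + t) * a + x′ * b           <⟨ +-monoʳ-< _ (⌈m/n⌉*n<m+n (suc j * a) b b>0) ⟩
    (x + t) * a + (suc j * a + b)  ≡⟨ regroup x j t a b ⟩
    (x + j + t) * a + (a + b)      ∎
    where
    regroup : ∀ x j t a b → (x + t) * a + (suc j * a + b) ≡ (x + j + t) * a + (a + b)
    regroup = solve-∀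

module MaxPath (a b : ℕ) (b>0 : 0 < b) where

  X = cornerX a b
  Y = pathX a b

  private
    a+b>0 : 0 < a + b
    a+b>0 = ≤-trans b>0 (m≤n+m b a)

    Y≤ : ∀ p → Y p ≤ p
    Y≤ p = ⌈m/n⌉≤q (p * a) (a + b) p a+b>0 (*-monoʳ-≤ p (m≤m+n a b))

  private
    lhs-split : ∀ p → suc p * a ≡ suc (p ∸ Y p) * a + Y p * a
    lhs-split p = trans (cong (λ z → suc z * a) (sym (m∸n+n≡m (Y≤ p)))) (split (p ∸ Y p) (Y p) a)
      where
      split : ∀ y x a → suc (y + x) * a ≡ suc y * a + x * a
      split = solve-∀

    rhs-split : ∀ p → Y p * (a + b) ≡ b * Y p + Y p * a
    rhs-split p = split b (Y p) a
      where
      split : ∀ b x a → x * (a + b) ≡ b * x + x * a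
      split = solve-∀

  north-test⇒ : ∀ p → suc (p ∸ Y p) * a ≤ b * Y p → Y (suc p) ≤ Y p
  north-test⇒ p north = ⌈m/n⌉≤q (suc p * a) (a + b) (Y p) a+b>0
    (subst₂ _≤_ (sym (lhs-split p)) (sym (rhs-split p)) (+-monoˡ-≤ (Y p * a) north))

  north-test⇐ : ∀ p → Y (suc p) ≤ Y p → suc (p ∸ Y p) * a ≤ b * Y p
  north-test⇐ p step = +-cancelʳ-≤ (Y p * a) _ _
    (subst₂ _≤_ (lhs-split p) (rhs-split p) (⌈m/n⌉≤q⇒m≤q*n (suc p * a) (a + b) (Y p) a+b>0 step))

  maxPathGo≡walk : ∀ f p → maxPathGo a b f (Y p) (p ∸ Y p) ≡ walk Y p f
  maxPathGo≡walk zero    p = refl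
  maxPathGo≡walk (suc f) p with suc (p ∸ Y p) * a ≤? b * Y p
  ... | yes north = cong₂ _∷_ (sym (stepAt-N Y p stay))
        (trans (cong₂ (maxPathGo a b f) (sym stay) (trans (sym (+-∸-assoc 1 (Y≤ p))) (cong (suc p ∸_) (sym stay))))
               (maxPathGo≡walk f (suc p)))
    where
    stay : Y (suc p) ≡ Y p
    stay = ≤-antisym (north-test⇒ p north) (proj₁ (pathX-unitSteps a b b>0 p))
  ... | no east = cong₂ _∷_ (sym (stepAt-E Y p move))
        (trans (cong₂ (maxPathGo a b f) (sym move) (cong (suc p ∸_) (sym move)))
               (maxPathGo≡walk f (suc p)))
    where
    move : Y (suc p) ≡ suc (Y p)
    move = ≤-antisym (proj₂ (pathX-unitSteps a b b>0 p)) (≰⇒> (λ stay → east (north-test⇐ p stay)))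

  maxPath≡walk : maxPath a b ≡ walk Y 0 (a + b)
  maxPath≡walk = trans (cong₂ (maxPathGo a b (a + b)) (sym Y0) (cong (0 ∸_) (sym Y0))) (maxPathGo≡walk (a + b) 0)
    where
    Y0 : Y 0 ≡ 0
    Y0 = n≤0⇒n≡0 (Y≤ 0)

  private
    Dw = maxPath a b

    take-maxPath : ∀ p → p ≤ a + b → take p Dw ≡ walk Y 0 p
    take-maxPath p p≤ rewrite maxPath≡walk = take-walk Y 0 p (a + b) p≤

    Y0 : Y 0 ≡ 0
    Y0 = n≤0⇒n≡0 (Y≤ 0)

    height+Y : ∀ p → p ≤ a + b → countN (take p Dw) + Y p ≡ p
    height+Y p p≤ rewrite take-maxPath p p≤ =
      trans (countN-walk (pathX-unitSteps a b b>0) 0 p) (trans (cong (p +_) Y0) (+-identityʳ p))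

    abscissa : ∀ p → p ≤ a + b → countE (take p Dw) ≡ Y p
    abscissa p p≤ rewrite take-maxPath p p≤ =
      trans (sym (+-identityʳ _)) (trans (cong (countE (walk Y 0 p) +_) (sym Y0)) (countE-walk (pathX-unitSteps a b b>0) 0 p))

    Y-corner : ∀ j → Y (X j + j) ≡ X j
    Y-corner j = trans (cong Y (sym (+-identityʳ (X j + j)))) (trans (pathX-rowsOf a b b>0 j 0 z≤n) (+-identityʳ _))

    corner≤ : ∀ j → j ≤ b → X j + j ≤ a + b
    corner≤ j j≤b = +-mono-≤ (≤-trans (monotone-≤ (cornerX-monotone a b b>0) j≤b) (≤-reflexive (cornerX-top a b b>0))) j≤b

    height-corner : ∀ j → j ≤ b → countN (take (X j + j) Dw) ≡ j
    height-corner j j≤b = +-cancelʳ-≡ (X j) _ _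
      (trans (cong (countN (take (X j + j) Dw) +_) (sym (Y-corner j)))
             (trans (height+Y (X j + j) (corner≤ j j≤b)) (+-comm (X j) j)))

    -- A vertex at height j satisfies p a ≤ Y p (a + b) with p = Y p + j, i.e. j a ≤ Y p b, so Y p ≥ X j.
    height-before-corner : ∀ j p → j ≤ b → p < X j + j → countN (take p Dw) ≢ j
    height-before-corner j p j≤b p<corner height≡j = <-irrefl refl (<-≤-trans p<corner (begin
        X j + j  ≤⟨ +-monoˡ-≤ j (⌈m/n⌉≤q (j * a) b (Y p) b>0 (+-cancelʳ-≤ (Y p * a) (j * a) (Y p * b) ja≤)) ⟩
        Y p + j  ≡⟨ Yp+j≡p ⟩
        p        ∎))
      where
      open ≤-Reasoning
      p≤ : p ≤ a + b
      p≤ = <⇒≤ (<-≤-trans p<corner (corner≤ j j≤b))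
      Yp+j≡p : Y p + j ≡ p
      Yp+j≡p = trans (+-comm (Y p) j) (trans (cong (_+ Y p) (sym height≡j)) (height+Y p p≤))
      ja≤ : j * a + Y p * a ≤ Y p * b + Y p * a
      ja≤ = begin
        j * a + Y p * a      ≡⟨ sym (*-distribʳ-+ a j (Y p)) ⟩
        (j + Y p) * a        ≡⟨ cong (_* a) (trans (+-comm j (Y p)) Yp+j≡p) ⟩
        p * a                ≤⟨ m≤⌈m/n⌉*n (p * a) (a + b) a+b>0 ⟩
        Y p * (a + b)        ≡⟨ trans (*-distribˡ-+ (Y p) a b) (+-comm (Y p * a) (Y p * b)) ⟩
        Y p * b + Y p * a    ∎

    length-maxPath : length Dw ≡ a + b
    length-maxPath rewrite maxPath≡walk = length-walk Y 0 (a + b)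

  corner-maxPath : ∀ j → j ≤ b → corner Dw j ≡ X j + j
  corner-maxPath j j≤b rewrite length-maxPath =
    firstHit≡ (λ p → ⌊ proj₂ (vertex Dw p) ≟ j ⌋) (a + b) 0 (X j + j) z≤n (corner≤ j j≤b)
      (trans (isYes≗does _) (dec-true (_ ≟ j) (height-corner j j≤b)))
      (λ p _ p<corner → trans (isYes≗does _) (dec-false (_ ≟ j) (height-before-corner j p j≤b p<corner)))

  vertex-corner : ∀ j → j ≤ b → vertex Dw (corner Dw j) ≡ (X j , j)
  vertex-corner j j≤b rewrite corner-maxPath j j≤b =
    cong₂ _,_ (trans (abscissa (X j + j) (corner≤ j j≤b)) (Y-corner j)) (height-corner j j≤b)

  subpath-corners : ∀ i k → i ≤ k → k ≤ b →
    take (corner Dw k ∸ corner Dw i) (drop (corner Dw i) Dw) ≡ staircase X i (k ∸ i)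
  subpath-corners i k i≤k k≤b
    rewrite corner-maxPath i (≤-trans i≤k k≤b) | corner-maxPath k k≤b | maxPath≡walk
          | drop-walk Y 0 (X i + i) (a + b)
          | take-walk Y (X i + i) ((X k + k) ∸ (X i + i)) ((a + b) ∸ (X i + i)) (∸-monoˡ-≤ (X i + i) (corner≤ k k≤b))
    = trans (cong (λ z → walk Y (X i + i) ((X z + z) ∸ (X i + i))) (sym (m+[n∸m]≡n i≤k)))
            (walk≡staircase (cornerX-monotone a b b>0) (pathX-rowsOf a b b>0) (k ∸ i) i)

-- Iterating λ on staircases of lines

staircase-line≡walk : ∀ p d → 0 < d → staircase (cornerX p d) 0 d ≡ walk (pathX p d) 0 (p + d)
staircase-line≡walk p d d>0 = sym (trans (cong₂ (walk (pathX p d)) (sym start) (sym len))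
  (walk≡staircase (cornerX-monotone p d d>0) (pathX-rowsOf p d d>0) d 0))
  where
  start : cornerX p d 0 + 0 ≡ 0
  start = trans (+-identityʳ _) (cornerX-zero p d d>0)
  len : (cornerX p d d + d) ∸ (cornerX p d 0 + 0) ≡ p + d
  len = cong₂ _∸_ (cong (_+ d) (cornerX-top p d d>0)) start

pathX+k*≡cornerX : ∀ p d k h → 0 < d → pathX p d h + k * h ≡ cornerX (p + k * (p + d)) (p + d) h
pathX+k*≡cornerX p d k h d>0 = sym (⌈m/n⌉≡q (h * (p + k * L)) L (x + k * h) L>0 lower upper)
  where
  open ≤-Reasoning
  L = p + d
  L>0 = ≤-trans d>0 (m≤n+m d p)
  x = pathX p d h
  expand : ∀ h p k L → h * (p + k * L) ≡ h * p + k * h * L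
  expand = solve-∀
  distrib : ∀ x k h L → (x + k * h) * L ≡ x * L + k * h * L
  distrib = solve-∀
  lower : h * (p + k * L) ≤ (x + k * h) * L
  lower = begin
    h * (p + k * L)    ≡⟨ expand h p k L ⟩
    h * p + k * h * L  ≤⟨ +-monoˡ-≤ (k * h * L) (m≤⌈m/n⌉*n (h * p) L L>0) ⟩
    x * L + k * h * L  ≡⟨ sym (distrib x k h L) ⟩
    (x + k * h) * L    ∎
  upper : (x + k * h) * L < h * (p + k * L) + L
  upper = begin-strict
    (x + k * h) * L        ≡⟨ distrib x k h L ⟩
    x * L + k * h * L      <⟨ +-monoˡ-< (k * h * L) (⌈m/n⌉*n<m+n (h * p) L L>0) ⟩
    h * p + L + k * h * L  ≡⟨ regroup h p k L ⟩
    h * (p + k * L) + L    ∎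
    where
    regroup : ∀ h p k L → h * p + L + k * h * L ≡ h * (p + k * L) + L
    regroup = solve-∀

λmor-staircase-line : ∀ {r} → 2 ≤ r → ∀ p d → 0 < d →
  λmor r (staircase (cornerX p d) 0 d) ≡ staircase (cornerX (p + (r ∸ 2) * (p + d)) (p + d)) 0 (p + d)
λmor-staircase-line {r} r≥2 p d d>0 = begin
    λmor r (staircase (cornerX p d) 0 d)                   ≡⟨ cong (λmor r) (staircase-line≡walk p d d>0) ⟩
    λmor r (walk (pathX p d) 0 (p + d))                    ≡⟨ λmor-walk r≥2 (pathX-unitSteps p d d>0) 0 (p + d) ⟩
    staircase (λ h → pathX p d h + (r ∸ 2) * h) 0 (p + d)
      ≡⟨ staircase-cong _ _ 0 0 (p + d) (λ l _ → cong₂ _∸_ (rewrite-X (suc l)) (rewrite-X l)) ⟩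
    staircase (cornerX (p + (r ∸ 2) * (p + d)) (p + d)) 0 (p + d) ∎
  where
  open ≡-Reasoning
  rewrite-X : ∀ h → pathX p d h + (r ∸ 2) * h ≡ cornerX (p + (r ∸ 2) * (p + d)) (p + d) h
  rewrite-X h = pathX+k*≡cornerX p d (r ∸ 2) h d>0

iterEnd : ℕ → ℕ → ℕ → ℕ × ℕ
iterEnd r p₀ zero    = p₀ , 1
iterEnd r p₀ (suc j) = let (p , d) = iterEnd r p₀ j in p + (r ∸ 2) * (p + d) , p + d

iterEndX iterEndY : ℕ → ℕ → ℕ → ℕ
iterEndX r p₀ j = proj₁ (iterEnd r p₀ j)
iterEndY r p₀ j = proj₂ (iterEnd r p₀ j)

iterEndY>0 : ∀ r p₀ j → 0 < iterEndY r p₀ j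
iterEndY>0 r p₀ zero    = z<s
iterEndY>0 r p₀ (suc j) = ≤-trans (iterEndY>0 r p₀ j) (m≤n+m _ _)

iter-λmor≡staircase : ∀ {r} → 2 ≤ r → ∀ p₀ j →
  iter j (λmor r) (replicate p₀ E ++ N ∷ []) ≡ staircase (cornerX (iterEndX r p₀ j) (iterEndY r p₀ j)) 0 (iterEndY r p₀ j)
iter-λmor≡staircase r≥2 p₀ zero = cong (λ e → replicate e E ++ N ∷ [])
  (sym (cong₂ _∸_ (cornerX-top p₀ 1 z<s) (cornerX-zero p₀ 1 z<s)))
iter-λmor≡staircase {r} r≥2 p₀ (suc j) = trans (cong (λmor r) (iter-λmor≡staircase r≥2 p₀ j))
  (λmor-staircase-line r≥2 (iterEndX r p₀ j) (iterEndY r p₀ j) (iterEndY>0 r p₀ j))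

length-staircase-line : ∀ p d → 0 < d → length (staircase (cornerX p d) 0 d) ≡ p + d
length-staircase-line p d d>0 = +-cancelʳ-≡ (cornerX p d 0) _ _ (begin
    length (staircase (cornerX p d) 0 d) + cornerX p d 0  ≡⟨ length-staircase (cornerX-monotone p d d>0) 0 d ⟩
    cornerX p d d + d                                     ≡⟨ cong (_+ d) (cornerX-top p d d>0) ⟩
    p + d                                                 ≡⟨ sym (trans (cong (p + d +_) (cornerX-zero p d d>0)) (+-identityʳ _)) ⟩
    p + d + cornerX p d 0                                 ∎)
  where open ≡-Reasoning

module Sequence (r : ℕ) (r≥2 : 2 ≤ r) where

  C = c r

  m+m≤r*m : ∀ m → m + m ≤ r * m
  m+m≤r*m m = ≤-trans (≤-reflexive (cong (m +_) (sym (+-identityʳ m)))) (*-monoˡ-≤ m r≥2)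

  c-step : ∀ k → C (suc k) ≤ C (suc (suc k))
  c-step zero    = z≤n
  c-step (suc k) = m+n≤o⇒m≤o∸n (C (suc (suc k)))
    (≤-trans (+-monoʳ-≤ (C (suc (suc k))) (c-step k)) (m+m≤r*m _))

  c-monotone : Monotone C
  c-monotone zero    = z≤n
  c-monotone (suc k) = c-step k

  -- The recurrence without truncated subtraction.
  c-rec : ∀ k → C (suc (suc (suc k))) + C (suc k) ≡ r * C (suc (suc k))
  c-rec k = m∸n+n≡m (≤-trans (c-step k) (≤-trans (m≤m+n _ _) (m+m≤r*m _)))

  c-strict : ∀ k → C (suc k) < C (suc (suc k))
  c-strict zero    = z<s
  c-strict (suc k) = +-cancelʳ-< (C (suc k)) (C (suc (suc k))) (C (suc (suc (suc k)))) (begin-strict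
      C (suc (suc k)) + C (suc k)          <⟨ +-monoʳ-< (C (suc (suc k))) (c-strict k) ⟩
      C (suc (suc k)) + C (suc (suc k))    ≤⟨ m+m≤r*m _ ⟩
      r * C (suc (suc k))                  ≡⟨ sym (c-rec k) ⟩
      C (suc (suc (suc k))) + C (suc k)    ∎)
    where open ≤-Reasoning

  c-product : ∀ J t → C (suc (suc J)) * C (suc (J + t)) ≡ C (suc J) * C (suc (suc (J + t))) + C (suc t)
  c-product zero    t = *-identityˡ _
  c-product (suc J) t = +-cancelʳ-≡ (C (suc J) * z) _ _ (begin
      C (suc (suc (suc J))) * z + C (suc J) * z  ≡⟨ sym (*-distribʳ-+ z (C (suc (suc (suc J)))) (C (suc J))) ⟩
      (C (suc (suc (suc J))) + C (suc J)) * z    ≡⟨ cong (_* z) (c-rec J) ⟩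
      r * y * z                                  ≡⟨ shuffle r y z ⟩
      y * (r * z)                                ≡⟨ cong (y *_) (sym (c-rec (J + t))) ⟩
      y * (C (suc (suc (suc (J + t)))) + C (suc (J + t)))
        ≡⟨ *-distribˡ-+ y _ (C (suc (J + t))) ⟩
      y * C (suc (suc (suc (J + t)))) + y * C (suc (J + t))
        ≡⟨ cong (y * C (suc (suc (suc (J + t)))) +_) (c-product J t) ⟩
      y * C (suc (suc (suc (J + t)))) + (C (suc J) * z + C (suc t))
        ≡⟨ regroup (y * C (suc (suc (suc (J + t))))) (C (suc J) * z) (C (suc t)) ⟩
      y * C (suc (suc (suc (J + t)))) + C (suc t) + C (suc J) * z  ∎)
    where
    open ≡-Reasoning
    y = C (suc (suc J))
    z = C (suc (suc (J + t)))
    shuffle : ∀ r y z → r * y * z ≡ y * (r * z)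
    shuffle = solve-∀
    regroup : ∀ u v w → u + (v + w) ≡ u + w + v
    regroup = solve-∀

  cassini : ∀ J → C (suc (suc J)) * C (suc (suc J)) ≡ C (suc (suc (suc J))) * C (suc J) + 1
  cassini J = begin
      C (suc (suc J)) * C (suc (suc J))        ≡⟨ cong (λ z → C (suc (suc J)) * C (suc z)) (sym (+-comm J 1)) ⟩
      C (suc (suc J)) * C (suc (J + 1))        ≡⟨ c-product J 1 ⟩
      C (suc J) * C (suc (suc (J + 1))) + 1    ≡⟨ cong (λ z → C (suc J) * C (suc (suc z)) + 1) (+-comm J 1) ⟩
      C (suc J) * C (suc (suc (suc J))) + 1    ≡⟨ cong (_+ 1) (*-comm (C (suc J)) _) ⟩
      C (suc (suc (suc J))) * C (suc J) + 1    ∎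
    where open ≡-Reasoning

  -- The second differences of c are (r - 2) c_{l+1}.
  c-convex : ∀ l → C (suc l) + C (suc l) ≤ C (suc (suc l)) + C l
  c-convex zero    = z≤n
  c-convex (suc l) = ≤-trans (m+m≤r*m _) (≤-reflexive (sym (c-rec l)))

  c-convex-gap : ∀ k e → C (suc k) + C (k + e) ≤ C (suc (k + e)) + C k
  c-convex-gap k zero rewrite +-identityʳ k = ≤-refl
  c-convex-gap k (suc e) rewrite +-suc k e = +-cancelʳ-≤ (C (suc (k + e))) _ _ (begin
      C (suc k) + C (suc (k + e)) + C (suc (k + e))      ≡⟨ +-assoc (C (suc k)) _ _ ⟩
      C (suc k) + (C (suc (k + e)) + C (suc (k + e)))    ≤⟨ +-monoʳ-≤ (C (suc k)) (c-convex (k + e)) ⟩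
      C (suc k) + (C (suc (suc (k + e))) + C (k + e))    ≡⟨ swap (C (suc k)) (C (suc (suc (k + e)))) (C (k + e)) ⟩
      C (suc (suc (k + e))) + (C (suc k) + C (k + e))    ≤⟨ +-monoʳ-≤ (C (suc (suc (k + e)))) (c-convex-gap k e) ⟩
      C (suc (suc (k + e))) + (C (suc (k + e)) + C k)    ≡⟨ regroup (C (suc (suc (k + e)))) (C (suc (k + e))) (C k) ⟩
      C (suc (suc (k + e))) + C k + C (suc (k + e))      ∎)
    where
    open ≤-Reasoning
    swap : ∀ u v w → u + (v + w) ≡ v + (u + w)
    swap = solve-∀
    regroup : ∀ u v w → u + (v + w) ≡ u + w + v
    regroup = solve-∀

-- The heights H j of the words λ^j (E^{r-w-1} N)

module Heights (r w : ℕ) (r≥2 : 2 ≤ r) (w≥2 : 2 ≤ w) (w<r : w < r) where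

  open Sequence r r≥2

  p₀ = r ∸ w ∸ 1

  H : ℕ → ℕ
  H = iterEndY r p₀

  H-rec : ∀ j → H (suc (suc j)) + H j ≡ r * H (suc j)
  H-rec j = trans (collect (iterEndX r p₀ j) (H j) (r ∸ 2)) (cong (_* H (suc j)) (m+[n∸m]≡n r≥2))
    where
    collect : ∀ p d k → p + k * (p + d) + (p + d) + d ≡ (2 + k) * (p + d)
    collect = solve-∀

  H+w*c : ∀ j → H j + w * C (suc j) ≡ C (suc (suc j))
  H+w*c zero = cong suc (*-zeroʳ w)
  H+w*c (suc zero) = begin
      p₀ + 1 + w * 1   ≡⟨ cong (p₀ + 1 +_) (*-identityʳ w) ⟩
      p₀ + 1 + w       ≡⟨ cong (_+ w) (trans (+-comm p₀ 1) (m+[n∸m]≡n (m+n≤o⇒m≤o∸n 1 w<r))) ⟩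
      r ∸ w + w        ≡⟨ m∸n+n≡m (<⇒≤ w<r) ⟩
      r                ≡⟨ sym (*-identityʳ r) ⟩
      r * 1            ∎
    where open ≡-Reasoning
  H+w*c (suc (suc j)) = +-cancelʳ-≡ (C (suc (suc j))) _ _ (begin
      H (suc (suc j)) + w * C (suc (suc (suc j))) + C (suc (suc j))
        ≡⟨ cong (H (suc (suc j)) + w * C (suc (suc (suc j))) +_) (sym (H+w*c j)) ⟩
      H (suc (suc j)) + w * C (suc (suc (suc j))) + (H j + w * C (suc j))
        ≡⟨ regroup (H (suc (suc j))) w (C (suc (suc (suc j)))) (H j) (C (suc j)) ⟩
      (H (suc (suc j)) + H j) + w * (C (suc (suc (suc j))) + C (suc j))
        ≡⟨ cong₂ (λ x y → x + w * y) (H-rec j) (c-rec j) ⟩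
      r * H (suc j) + w * (r * C (suc (suc j)))
        ≡⟨ factor r (H (suc j)) w (C (suc (suc j))) ⟩
      r * (H (suc j) + w * C (suc (suc j)))
        ≡⟨ cong (r *_) (H+w*c (suc j)) ⟩
      r * C (suc (suc (suc j)))
        ≡⟨ sym (c-rec (suc j)) ⟩
      C (suc (suc (suc (suc j)))) + C (suc (suc j)) ∎)
    where
    open ≡-Reasoning
    regroup : ∀ x w y z u → x + w * y + (z + w * u) ≡ (x + z) + w * (y + u)
    regroup = solve-∀
    factor : ∀ r x w y → r * x + w * (r * y) ≡ r * (x + w * y)
    factor = solve-∀

  H-product : ∀ J t →
    H (suc (suc J)) * C (suc (suc (suc (J + t)))) + w * C (suc (suc t))
      ≡ H (suc J) * C (suc (suc (suc (suc (J + t))))) + C (suc t)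
  H-product J t = +-cancelʳ-≡ (w * (c₂ * B′)) _ _ (begin
      s * B + w * u₂ + w * (c₂ * B′)  ≡⟨ regroup s B w u₂ (c₂ * B′) ⟩
      s * B + w * (c₂ * B′ + u₂)      ≡⟨ cong (λ z → s * B + w * z) (sym product₂) ⟩
      s * B + w * (c₃ * B)           ≡⟨ factor s B w c₃ ⟩
      (s + w * c₃) * B               ≡⟨ cong (_* B) (H+w*c (suc (suc J))) ⟩
      c₄ * B                         ≡⟨ product₁ ⟩
      c₃ * B′ + u                    ≡⟨ cong (λ z → z * B′ + u) (sym (H+w*c (suc J))) ⟩
      (d + w * c₂) * B′ + u          ≡⟨ expand d w c₂ B′ u ⟩
      d * B′ + u + w * (c₂ * B′)     ∎)
    where
    open ≡-Reasoning
    d = H (suc J)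
    s = H (suc (suc J))
    c₂ = C (suc (suc J))
    c₃ = C (suc (suc (suc J)))
    c₄ = C (suc (suc (suc (suc J))))
    B = C (suc (suc (suc (J + t))))
    B′ = C (suc (suc (suc (suc (J + t)))))
    u = C (suc t)
    u₂ = C (suc (suc t))
    product₁ : c₄ * B ≡ c₃ * B′ + u
    product₁ = c-product (suc (suc J)) t
    product₂ : c₃ * B ≡ c₂ * B′ + u₂
    product₂ = subst (λ z → c₃ * C (suc z) ≡ c₂ * C (suc (suc z)) + u₂) (+-suc (suc J) t) (c-product (suc J) (suc t))
    regroup : ∀ s B w x z → s * B + w * x + w * z ≡ s * B + w * (z + x)
    regroup = solve-∀
    factor : ∀ s B w c → s * B + w * (c * B) ≡ (s + w * c) * B
    factor = solve-∀
    expand : ∀ d w c B u → (d + w * c) * B + u ≡ d * B + u + w * (c * B)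
    expand = solve-∀

  H-cassini : ∀ J → H (suc J) * C (suc (suc (suc J))) ≡ H (suc (suc J)) * C (suc (suc J)) + 1
  H-cassini J = +-cancelʳ-≡ (w * c₂ * c₃) _ _ (begin
      d * c₃ + w * c₂ * c₃   ≡⟨ sym (*-distribʳ-+ c₃ d (w * c₂)) ⟩
      (d + w * c₂) * c₃      ≡⟨ cong (_* c₃) (H+w*c (suc J)) ⟩
      c₃ * c₃                ≡⟨ cassini (suc J) ⟩
      c₄ * c₂ + 1            ≡⟨ cong (λ z → z * c₂ + 1) (sym (H+w*c (suc (suc J)))) ⟩
      (s + w * c₃) * c₂ + 1  ≡⟨ expand s w c₃ c₂ ⟩
      s * c₂ + 1 + w * c₂ * c₃ ∎)
    where
    open ≡-Reasoning
    d = H (suc J)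
    s = H (suc (suc J))
    c₂ = C (suc (suc J))
    c₃ = C (suc (suc (suc J)))
    c₄ = C (suc (suc (suc (suc J))))
    expand : ∀ s w c c′ → (s + w * c) * c′ + 1 ≡ s * c′ + 1 + w * c′ * c
    expand = solve-∀

  -- r ≥ w + 1 ≥ 3 makes c grow faster than doubling, and convexity carries this from M to J.
  c<H : ∀ M J → M ≤ J → 0 < C (suc M) → C (suc M) < H (suc J)
  c<H zero     J _   ()
  c<H (suc M) J M<J _  = +-cancelʳ-< cM _ _ (begin-strict
      cM + cM               <⟨ c₃>2c₂ ⟩
      cM₊                   ≤⟨ +-cancelʳ-≤ (C (suc J)) _ _ (begin
          cM₊ + C (suc J)                   ≤⟨ gap ⟩
          C (suc (suc J)) + cM              ≤⟨ +-monoˡ-≤ cM cJ≤ ⟩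
          H (suc J) + C (suc J) + cM        ≡⟨ swap (H (suc J)) (C (suc J)) cM ⟩
          H (suc J) + cM + C (suc J)        ∎) ⟩
      H (suc J) + cM        ∎)
    where
    open ≤-Reasoning
    cM = C (suc (suc M))
    cM₊ = C (suc (suc (suc M)))
    swap : ∀ a b c → a + b + c ≡ a + c + b
    swap = solve-∀
    c₃>2c₂ : cM + cM < cM₊
    c₃>2c₂ = +-cancelʳ-< (C (suc M)) _ _ (begin-strict
      cM + cM + C (suc M)  <⟨ +-monoʳ-< (cM + cM) (c-strict M) ⟩
      cM + cM + cM         ≡⟨ thrice cM ⟩
      3 * cM               ≤⟨ *-monoˡ-≤ cM (≤-trans (s≤s w≥2) w<r) ⟩
      r * cM               ≡⟨ sym (c-rec M) ⟩
      cM₊ + C (suc M)      ∎)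
      where
      thrice : ∀ a → a + a + a ≡ 3 * a
      thrice = solve-∀
    gap : cM₊ + C (suc J) ≤ C (suc (suc J)) + cM
    gap = subst (λ z → cM₊ + C (suc z) ≤ C (suc (suc z)) + cM) (m+[n∸m]≡n M<J) (c-convex-gap (suc (suc M)) (J ∸ suc M))
    cJ≤ : C (suc (suc J)) ≤ H (suc J) + C (suc J)
    cJ≤ = +-cancelʳ-≤ (w * C (suc (suc J))) _ _ (begin
      suc w * C (suc (suc J))                          ≤⟨ *-monoˡ-≤ _ w<r ⟩
      r * C (suc (suc J))                              ≡⟨ sym (c-rec J) ⟩
      C (suc (suc (suc J))) + C (suc J)                ≡⟨ cong (_+ C (suc J)) (sym (H+w*c (suc J))) ⟩
      H (suc J) + w * C (suc (suc J)) + C (suc J)      ≡⟨ swap (H (suc J)) (w * C (suc (suc J))) (C (suc J)) ⟩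
      H (suc J) + C (suc J) + w * C (suc (suc J))      ∎)

  ⌈H*c/c⌉ : ∀ M J → H (suc J) ≤ C (suc M) → 0 < C (suc M) →
    ⌈ H (suc J) * C (suc (suc M)) / C (suc M) ⌉ ≡ suc (H (suc (suc J)))
  ⌈H*c/c⌉ M J H≤c c>0 with suc (suc J) ≤? M
  ... | yes J+2≤M rewrite sym (m+[n∸m]≡n J+2≤M) = far J (M ∸ suc (suc J))
    where
    far : ∀ J t → ⌈ H (suc J) * C (suc (suc (suc (suc (J + t))))) / C (suc (suc (suc (J + t)))) ⌉ ≡ suc (H (suc (suc J)))
    far J t = ⌈m/n⌉≡1+q _ B (H (suc (suc J))) (≤-trans z<s (c-strict (suc (J + t))))
      (+-cancelʳ-< u _ _ (<-≤-trans (+-monoʳ-< _ u<wu₂) (≤-reflexive (H-product J t))))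
      (+-cancelʳ-≤ u _ _ (begin
        H (suc J) * B′ + u              ≡⟨ sym (H-product J t) ⟩
        H (suc (suc J)) * B + w * u₂    ≤⟨ +-monoʳ-≤ _ wu₂≤B+u ⟩
        H (suc (suc J)) * B + (B + u)   ≡⟨ sym (+-assoc _ B u) ⟩
        H (suc (suc J)) * B + B + u     ∎))
      where
      open ≤-Reasoning
      B = C (suc (suc (suc (J + t))))
      B′ = C (suc (suc (suc (suc (J + t)))))
      u = C (suc t)
      u₂ = C (suc (suc t))
      u<wu₂ : u < w * u₂
      u<wu₂ = <-≤-trans (c-strict t) (≤-trans (≤-reflexive (sym (*-identityˡ u₂))) (*-monoˡ-≤ u₂ (≤-trans z<s w≥2)))
      wu₂≤B+u : w * u₂ ≤ B + u
      wu₂≤B+u = +-cancelʳ-≤ u₂ _ _ (begin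
        w * u₂ + u₂                   ≡⟨ +-comm (w * u₂) u₂ ⟩
        suc w * u₂                    ≤⟨ *-monoˡ-≤ u₂ w<r ⟩
        r * u₂                        ≡⟨ sym (c-rec t) ⟩
        C (suc (suc (suc t))) + u     ≤⟨ +-monoˡ-≤ u (monotone-≤ c-monotone (s≤s (s≤s (s≤s (m≤n+m t J))))) ⟩
        B + u                         ≤⟨ m≤m+n (B + u) u₂ ⟩
        B + u + u₂                    ∎)
  ... | no J+2≰M with M ≟ suc J
  ...   | yes refl = ⌈m/n⌉≡1+q _ _ _ c>0 (≤-reflexive (trans (+-comm 1 _) (sym (H-cassini J))))
                       (≤-trans (≤-reflexive (H-cassini J)) (+-monoʳ-≤ _ c>0))
  ...   | no M≢J+1 = ⊥-elim (<⇒≱ (c<H M J (s≤s⁻¹ (≤∧≢⇒< (s≤s⁻¹ (≰⇒> J+2≰M)) M≢J+1)) c>0) H≤c)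

-- Corners of P(a,b) along a chord

chord<1+ : ∀ a b → 0 < b → ∀ i d → d * a < b * (cornerX a b (i + d) ∸ cornerX a b i) + b
chord<1+ a b b>0 i d = +-cancelˡ-< (i * a) _ _ (begin-strict
    i * a + d * a          ≡⟨ sym (*-distribʳ-+ a i d) ⟩
    (i + d) * a            ≤⟨ m≤⌈m/n⌉*n ((i + d) * a) b b>0 ⟩
    X (i + d) * b          ≡⟨ cong (_* b) (sym (m+[n∸m]≡n Xi≤)) ⟩
    (X i + p) * b          ≡⟨ *-distribʳ-+ b (X i) p ⟩
    X i * b + p * b        <⟨ +-monoˡ-< (p * b) (⌈m/n⌉*n<m+n (i * a) b b>0) ⟩
    i * a + b + p * b      ≡⟨ regroup (i * a) b p ⟩
    i * a + (b * p + b)    ∎)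
  where
  open ≤-Reasoning
  X = cornerX a b
  p = X (i + d) ∸ X i
  Xi≤ : X i ≤ X (i + d)
  Xi≤ = monotone-≤ (cornerX-monotone a b b>0) (m≤m+n i d)
  regroup : ∀ x b p → x + b + p * b ≡ x + (b * p + b)
  regroup = solve-∀

weighted<⇒< : ∀ j e A B → j * B + (j + e) * A < j * A + (j + e) * B → A < B
weighted<⇒< j e A B lt = *-cancelˡ-< e A B (+-cancelˡ-< (j * B + j * A) (e * A) (e * B)
    (subst₂ _<_ (expand j e A B) (expand′ j e A B) lt))
  where
  expand : ∀ j e A B → j * B + (j + e) * A ≡ j * B + j * A + e * A
  expand = solve-∀
  expand′ : ∀ j e A B → j * A + (j + e) * B ≡ j * B + j * A + e * B
  expand′ = solve-∀

-- If the chord from the corner at height i to the one at height i + d is strictly steeper than the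
-- diagonal, and no shorter chord from height i is, then in between P(a,b) follows P(p,d).
module FirstSteepChord (a b i d p : ℕ) (b>0 : 0 < b) (d>0 : 0 < d)
  (steep : b * p < d * a)
  (end : cornerX a b (i + d) ≡ cornerX a b i + p)
  (first : ∀ j → 0 < j → j < d → j * a ≤ b * (cornerX a b (i + j) ∸ cornerX a b i)) where

  private
    X = cornerX a b

    instance
      b≢0 : NonZero b
      b≢0 = >-nonZero b>0
      d≢0 : NonZero d
      d≢0 = >-nonZero d>0

    interior : ∀ j → 0 < j → j < d → X (i + j) ∸ X i ≡ cornerX p d j
    interior j j>0 j<d = sym (⌈m/n⌉≡q (j * p) d x d>0 lower upper)
      where
      open ≤-Reasoning
      x = X (i + j) ∸ X i
      Xi+x : X (i + j) ≡ X i + x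
      Xi+x = sym (m+[n∸m]≡n (monotone-≤ (cornerX-monotone a b b>0) (m≤m+n i j)))
      lower : j * p ≤ x * d
      lower = *-cancelˡ-≤ b (begin
        b * (j * p)  ≡⟨ shuffle b j p ⟩
        j * (b * p)  ≤⟨ *-monoʳ-≤ j (<⇒≤ steep) ⟩
        j * (d * a)  ≡⟨ shuffle j d a ⟩
        d * (j * a)  ≤⟨ *-monoʳ-≤ d (first j j>0 j<d) ⟩
        d * (b * x)  ≡⟨ trans (shuffle d b x) (cong (b *_) (*-comm d x)) ⟩
        b * (x * d)  ∎)
        where
        shuffle : ∀ x y z → x * (y * z) ≡ y * (x * z)
        shuffle = solve-∀
      -- the corner at i + j lies below the line through the corner at i + d
      below : x * b + d * a < j * a + b + p * b
      below = +-cancelˡ-< (X i * b + i * a) _ _ (subst₂ _<_ (regroup (X i) x b i d a) (regroup′ (X i) p b i j a)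
        (+-mono-<-≤ (subst (λ z → z * b < (i + j) * a + b) Xi+x (⌈m/n⌉*n<m+n ((i + j) * a) b b>0))
                    (subst (λ z → (i + d) * a ≤ z * b) end (m≤⌈m/n⌉*n ((i + d) * a) b b>0))))
        where
        regroup : ∀ y x b i d a → (y + x) * b + (i + d) * a ≡ y * b + i * a + (x * b + d * a)
        regroup = solve-∀
        regroup′ : ∀ y p b i j a → (i + j) * a + b + (y + p) * b ≡ y * b + i * a + (j * a + b + p * b)
        regroup′ = solve-∀
      upper : x * d < j * p + d
      upper = ≰⇒> λ jp+d≤xd → <-asym steep (weighted<⇒< j (d ∸ j) (d * a) (b * p)
        (subst (λ z → j * (b * p) + z * (d * a) < j * (d * a) + z * (b * p)) (sym (m+[n∸m]≡n (<⇒≤ j<d)))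
          (+-cancelʳ-< (b * d) _ _ (begin-strict
            j * (b * p) + d * (d * a) + b * d  ≡⟨ e₁ j b p d a ⟩
            b * (j * p + d) + d * (d * a)      ≤⟨ +-monoˡ-≤ (d * (d * a)) (*-monoʳ-≤ b jp+d≤xd) ⟩
            b * (x * d) + d * (d * a)          ≡⟨ e₂ b x d a ⟩
            d * (x * b + d * a)                <⟨ *-monoʳ-< d below ⟩
            d * (j * a + b + p * b)            ≡⟨ e₃ d j a b p ⟩
            j * (d * a) + d * (b * p) + b * d  ∎))))
        where
        e₁ : ∀ j b p d a → j * (b * p) + d * (d * a) + b * d ≡ b * (j * p + d) + d * (d * a)
        e₁ = solve-∀
        e₂ : ∀ b x d a → b * (x * d) + d * (d * a) ≡ d * (x * b + d * a)
        e₂ = solve-∀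
        e₃ : ∀ d j a b p → d * (j * a + b + p * b) ≡ j * (d * a) + d * (b * p) + b * d
        e₃ = solve-∀

  window : ∀ j → j ≤ d → X (i + j) ∸ X i ≡ cornerX p d j
  window zero    _   = trans (cong (λ z → X z ∸ X i) (+-identityʳ i)) (trans (n∸n≡0 (X i)) (sym (cornerX-zero p d d>0)))
  window (suc j) j<d with m≤n⇒m<n∨m≡n j<d
  ... | inj₁ j+1<d = interior (suc j) z<s j+1<d
  ... | inj₂ refl  = trans (cong (_∸ X i) end) (trans (m+n∸m≡n (X i) p) (sym (cornerX-top p d d>0)))

-- The subpath γ(i, t(i)) of D_n

[m∸o]∸[n∸o]≡m∸n : ∀ m {n o} → o ≤ n → (m ∸ o) ∸ (n ∸ o) ≡ m ∸ n
[m∸o]∸[n∸o]≡m∸n m {n} {o} o≤n = trans (∸-+-assoc m o (n ∸ o)) (cong (m ∸_) (m+[n∸m]≡n o≤n))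

module Window (r n′ i k : ℕ) (r≥2 : 2 ≤ r) (i<b : i < c r (suc n′))
  (isT : IsT r (suc (suc (suc n′))) i k) where

  private
    n = suc (suc (suc n′))
    a = Da r n
    b = Db r n
    b>0 : 0 < b
    b>0 = ≤-trans z<s i<b
    i<k = proj₁ isT
    k≤b = proj₁ (proj₂ isT)
    open MaxPath a b b>0

  d = k ∸ i
  p = X k ∸ X i

  private
    i+d≡k : i + d ≡ k
    i+d≡k = m+[n∸m]≡n (<⇒≤ i<k)

    steep : b * p < d * a
    steep = subst₂ (SlopeGt a b) (vertex-corner i (<⇒≤ i<b)) (vertex-corner k k≤b) (proj₁ (proj₂ (proj₂ isT)))

    end : X (i + d) ≡ X i + p
    end = trans (cong X i+d≡k) (sym (m+[n∸m]≡n (monotone-≤ (cornerX-monotone a b b>0) (<⇒≤ i<k))))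

    first : ∀ j → 0 < j → j < d → j * a ≤ b * (X (i + j) ∸ X i)
    first j j>0 j<d = subst (λ z → z * a ≤ b * (X (i + j) ∸ X i)) (m+n∸m≡n i j)
       (≮⇒≥ (λ steeper → proj₂ (proj₂ (proj₂ isT)) (i + j) i<i+j i+j<k
         (subst₂ (SlopeGt a b) (sym (vertex-corner i (<⇒≤ i<b))) (sym (vertex-corner (i + j) (≤-trans (<⇒≤ i+j<k) k≤b))) steeper)))
      where
      i<i+j : i < i + j
      i<i+j = subst (_< i + j) (+-identityʳ i) (+-monoʳ-< i j>0)
      i+j<k : i + j < k
      i+j<k = subst (i + j <_) i+d≡k (+-monoʳ-< i j<d)

    open FirstSteepChord a b i d p b>0 (m<n⇒0<n∸m i<k) steep end first

  γ≡staircase : γ r n i k ≡ staircase (cornerX p d) 0 d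
  γ≡staircase = trans (subpath-corners i k (<⇒≤ i<k) k≤b) (staircase-cong X (cornerX p d) i 0 d row)
    where
    row : ∀ l → l < d → X (suc (i + l)) ∸ X (i + l) ≡ cornerX p d (suc l) ∸ cornerX p d l
    row l l<d = begin
      X (suc (i + l)) ∸ X (i + l)                      ≡⟨ cong (λ z → X z ∸ X (i + l)) (sym (+-suc i l)) ⟩
      X (i + suc l) ∸ X (i + l)                        ≡⟨ sym ([m∸o]∸[n∸o]≡m∸n (X (i + suc l)) Xi≤) ⟩
      (X (i + suc l) ∸ X i) ∸ (X (i + l) ∸ X i)        ≡⟨ cong₂ _∸_ (window (suc l) l<d) (window l (<⇒≤ l<d)) ⟩
      cornerX p d (suc l) ∸ cornerX p d l              ∎
      where
      open ≡-Reasoning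
      Xi≤ : X i ≤ X (i + l)
      Xi≤ = monotone-≤ (cornerX-monotone a b b>0) (m≤m+n i l)

  d≤b : d ≤ c r (suc n′)
  d≤b = ≤-trans (m∸n≤m k i) k≤b

  ⌈d*c/c⌉ : ⌈ d * c r (suc (suc n′)) / c r (suc n′) ⌉ ≡ suc (p + d)
  ⌈d*c/c⌉ = ⌈m/n⌉≡1+q _ b (p + d) b>0 (begin-strict
      (p + d) * b        ≡⟨ *-distribʳ-+ b p d ⟩
      p * b + d * b      <⟨ +-monoˡ-< (d * b) (subst (_< d * a) (*-comm b p) steep) ⟩
      d * a + d * b      ≡⟨ sym (*-distribˡ-+ d a b) ⟩
      d * (a + b)        ≡⟨ cong (d *_) a+b ⟩
      d * c r (suc (suc n′))   ∎)
    (<⇒≤ (begin-strict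
      d * c r (suc (suc n′))   ≡⟨ cong (d *_) (sym a+b) ⟩
      d * (a + b)        ≡⟨ *-distribˡ-+ d a b ⟩
      d * a + d * b      <⟨ +-monoˡ-< (d * b) (subst (λ z → d * a < b * (X z ∸ X i) + b) i+d≡k (chord<1+ a b b>0 i d)) ⟩
      b * p + b + d * b  ≡⟨ regroup b p d ⟩
      (p + d) * b + b    ∎))
    where
    open ≤-Reasoning
    a+b : a + b ≡ c r (suc (suc n′))
    a+b = m∸n+n≡m (Sequence.c-step r r≥2 n′)
    regroup : ∀ b p d → b * p + b + d * b ≡ (p + d) * b + b
    regroup = solve-∀

lemma5p8 : (r n i k m w : ℕ) → 2 ≤ r → 3 ≤ n → i < c r (n ∸ 2) →
    IsT r n i k →
    3 ≤ m → 2 ≤ w → w ≤ r ∸ 1 →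
    (k ∸ i) + w * c r (m ∸ 1) ≡ c r m →
    (γ r n i k ≡ iter (m ∸ 2) (λmor r) (replicate (r ∸ w ∸ 1) E ++ (N ∷ [])))
    × (length (γ r n i k) + w * c r m ≡ c r (suc m))
lemma5p8 r (suc (suc (suc n′))) i k (suc (suc (suc J))) w r≥2 (s≤s (s≤s (s≤s _))) i<b isT (s≤s (s≤s (s≤s _)))
         w≥2 w≤r∸1 d+w*c≡c = γ≡iterate , length-γ
  where
  w<r : w < r
  w<r = ≤-trans (s≤s w≤r∸1) (≤-reflexive (m+[n∸m]≡n (≤-trans z<s r≥2)))
  open Window r n′ i k r≥2 i<b isT
  open Heights r w r≥2 w≥2 w<r
  open ≡-Reasoning

  d≡H : d ≡ H (suc J)
  d≡H = +-cancelʳ-≡ (w * c r (suc (suc J))) d (H (suc J)) (trans d+w*c≡c (sym (H+w*c (suc J))))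

  p+d≡H : p + d ≡ H (suc (suc J))
  p+d≡H = suc-injective (begin
    suc (p + d)                                           ≡⟨ sym ⌈d*c/c⌉ ⟩
    ⌈ d * c r (suc (suc n′)) / c r (suc n′) ⌉            ≡⟨ cong (λ h → ⌈ h * c r (suc (suc n′)) / c r (suc n′) ⌉) d≡H ⟩
    ⌈ H (suc J) * c r (suc (suc n′)) / c r (suc n′) ⌉    ≡⟨ ⌈H*c/c⌉ n′ J (subst (_≤ c r (suc n′)) d≡H d≤b) (≤-trans z<s i<b) ⟩
    suc (H (suc (suc J)))                                 ∎)

  p≡X : p ≡ iterEndX r p₀ (suc J)
  p≡X = +-cancelʳ-≡ d p (iterEndX r p₀ (suc J)) (trans p+d≡H (cong (iterEndX r p₀ (suc J) +_) (sym d≡H)))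

  γ≡line : γ r (suc (suc (suc n′))) i k ≡ staircase (cornerX (iterEndX r p₀ (suc J)) (H (suc J))) 0 (H (suc J))
  γ≡line = trans γ≡staircase (cong₂ (λ p′ d′ → staircase (cornerX p′ d′) 0 d′) p≡X d≡H)

  γ≡iterate : γ r (suc (suc (suc n′))) i k ≡ iter (suc J) (λmor r) (replicate p₀ E ++ N ∷ [])
  γ≡iterate = trans γ≡line (sym (iter-λmor≡staircase r≥2 p₀ (suc J)))

  length-γ : length (γ r (suc (suc (suc n′))) i k) + w * c r (suc (suc (suc J))) ≡ c r (suc (suc (suc (suc J))))
  length-γ = begin
    length (γ r (suc (suc (suc n′))) i k) + w * c r (suc (suc (suc J)))
      ≡⟨ cong (λ γ′ → length γ′ + w * c r (suc (suc (suc J)))) γ≡line ⟩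
    length (staircase (cornerX (iterEndX r p₀ (suc J)) (H (suc J))) 0 (H (suc J))) + w * c r (suc (suc (suc J)))
      ≡⟨ cong (_+ w * c r (suc (suc (suc J)))) (length-staircase-line _ _ (iterEndY>0 r p₀ (suc J))) ⟩
    H (suc (suc J)) + w * c r (suc (suc (suc J)))
      ≡⟨ H+w*c (suc (suc J)) ⟩
    c r (suc (suc (suc (suc J))))  ∎
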